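{- Let $n\ge 2$ and let $T$ be a rooted tree on the vertex set $\{1,\dots,n\}$ with slither code $(s_1,\dots,s_{n-1})$. Let $\alpha$ be the smallest number such that the prefix $(s_1,\dots,s_\alpha)$ contains at least $n-\alpha$ distinct numbers. Then $\alpha$ is the independence number of $T$, and $n-\alpha$ is the matching number of $T$.
   Context: Edges of $T$ are directed away from the root. A vertex is a $P$-position iff none of its children is a $P$-position (leaves are $P$-positions); otherwise it is an $N$-position. Slither code: start with $n-1$ empty slots; repeat $n-1$ times: among non-root vertices of the current tree with no remaining children, remove the one with smallest label and put its label into the leftmost empty slot if it is a $P$-position of the original tree $T$, otherwise into the rightmost empty slot. This gives $(a_1,\dots,a_{n-1})$; then $s_i$ is the parent of $a_i$ in $T$. Independence number: maximum size of a set of pairwise non-adjacent vertices; matching number: maximum size of a set of pairwise disjoint edges. -}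

module Defs where

open import Data.Nat using (ℕ; zero; suc; _∸_; _≤_; _<_)
open import Data.Fin using (Fin)
import Data.Fin as Fin
open import Data.Fin.Subset using (Subset; _∈_; ∣_∣)
open import Data.Bool using (Bool; true; false; not; _∧_; _∨_; if_then_else_)
open import Data.List using (List; []; _∷_; _++_; [_]; allFin; take; length; deduplicate; findᵇ; foldl)
open import Data.Bool.ListAction using (any; all)
open import Data.Maybe using (Maybe; just; nothing)
open import Data.Product using (Σ; _×_; _,_; ∃; proj₁; proj₂)
open import Data.Sum using (_⊎_)
open import Relation.Nullary using (¬_; does)
open import Relation.Binary.PropositionalEquality using (_≡_; _≢_)
open import Function using (_⇔_)

-- Vertex i : Fin n stands for the label toℕ i + 1 ∈ {1,…,n};
-- the order on Fin n is the order on labels.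
-- A rooted tree is given by its root and parent map (parent root = root,
-- by convention); edges are {v , parent v} for v ≢ root.  The tree
-- condition: every vertex reaches the root by iterating parent.
iter : ∀ {A : Set} → (A → A) → ℕ → A → A
iter f zero x = x
iter f (suc k) x = f (iter f k x)

record RootedTree (n : ℕ) : Set where
  field
    root      : Fin n
    parent    : Fin n → Fin n
    parent-root : parent root ≡ root
    reachesRoot : ∀ v → ∃ λ k → iter parent k v ≡ root
open RootedTree public

IsChild : ∀ {n} → RootedTree n → Fin n → Fin n → Set
IsChild T c v = c ≢ root T × parent T c ≡ v

-- P-positions: P v = true iff no child of v is a P-position
-- (so leaves are P-positions).  This specification has a unique solution.
IsPLabelling : ∀ {n} → RootedTree n → (Fin n → Bool) → Set
IsPLabelling {n} T P =
  ∀ v → (P v ≡ true) ⇔ (∀ c → IsChild T c v → P c ≡ false)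

eqb : ∀ {n} → Fin n → Fin n → Bool
eqb u v = does (u Fin.≟ v)

memb : ∀ {n} → Fin n → List (Fin n) → Bool
memb v xs = any (eqb v) xs

removable : ∀ {n} → RootedTree n → List (Fin n) → Fin n → Bool
removable {n} T rem v =
  not (eqb v (root T)) ∧ not (memb v rem) ∧
  all (λ u → not (eqb (parent T u) v) ∨ eqb u (root T) ∨ memb u rem) (allFin n)

nextRemoved : ∀ {n} → RootedTree n → List (Fin n) → Maybe (Fin n)
nextRemoved {n} T rem = findᵇ (removable T rem) (allFin n)

removeSteps : ∀ {n} → RootedTree n → ℕ → List (Fin n) → List (Fin n)
removeSteps T zero rem = rem
removeSteps T (suc k) rem with nextRemoved T rem
... | nothing = rem
... | just v  = removeSteps T k (rem ++ [ v ])

removalOrder : ∀ {n} → RootedTree n → List (Fin n)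
removalOrder {n} T = removeSteps T (n ∸ 1) []

-- slot filling: the filled left part and the filled right part;
-- "leftmost empty slot" appends to the left part, "rightmost empty slot"
-- prepends to the right part.  Final word = left ++ right.
placeSlot : ∀ {n} → (Fin n → Bool) → List (Fin n) × List (Fin n) → Fin n
          → List (Fin n) × List (Fin n)
placeSlot P (l , r) v = if P v then (l ++ [ v ] , r) else (l , v ∷ r)

slotWord : ∀ {n} → RootedTree n → (Fin n → Bool) → List (Fin n)
slotWord T P =
  let lr = foldl (placeSlot P) ([] , []) (removalOrder T) in proj₁ lr ++ proj₂ lr

slitherCode : ∀ {n} → RootedTree n → (Fin n → Bool) → List (Fin n)
slitherCode T P = Data.List.map (parent T) (slotWord T P)

distinctCount : ∀ {n} → List (Fin n) → ℕ
distinctCount xs = length (deduplicate Fin._≟_ xs)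

AlphaCond : (n : ℕ) → List (Fin n) → ℕ → Set
AlphaCond n s a = n ∸ a ≤ distinctCount (take a s)

IsSmallestAlpha : (n : ℕ) → List (Fin n) → ℕ → Set
IsSmallestAlpha n s a = AlphaCond n s a × (∀ b → b < a → ¬ AlphaCond n s b)

Adjacent : ∀ {n} → RootedTree n → Fin n → Fin n → Set
Adjacent T u v = IsChild T u v ⊎ IsChild T v u

IsIndependent : ∀ {n} → RootedTree n → Subset n → Set
IsIndependent T S = ∀ u v → u ∈ S → v ∈ S → ¬ Adjacent T u v

IsIndependenceNumber : ∀ {n} → RootedTree n → ℕ → Set
IsIndependenceNumber {n} T k =
  (Σ (Subset n) λ S → IsIndependent T S × ∣ S ∣ ≡ k) ×
  (∀ S → IsIndependent T S → ∣ S ∣ ≤ k)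

-- An edge set is encoded by the set M of child endpoints (each edge of T is
-- {v , parent v} for a unique non-root v).  Matching: distinct edges disjoint.
IsMatching : ∀ {n} → RootedTree n → Subset n → Set
IsMatching T M =
  (∀ v → v ∈ M → v ≢ root T) ×
  (∀ v w → v ∈ M → w ∈ M → v ≢ w →
     v ≢ parent T w × parent T v ≢ w × parent T v ≢ parent T w)

IsMatchingNumber : ∀ {n} → RootedTree n → ℕ → Set
IsMatchingNumber {n} T k =
  (Σ (Subset n) λ M → IsMatching T M × ∣ M ∣ ≡ k) ×
  (∀ M → IsMatching T M → ∣ M ∣ ≤ k)

{-# OPTIONS --safe #-}
-- A P-position has only N-children and every N-position has a P-child c(w).  Hence the
-- P-positions form an independent set, the edges {w , c(w)} for N-positions w form a
-- matching, an independent set injects into the P-positions (v ↦ v or c(v)) and a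
-- matching into the N-positions (each edge ↦ its N-endpoint).  So the independence
-- number is |P| and the matching number is |N| = n ∸ |P|.
--
-- The removal order lists every non-root vertex once, so the slither code starts with
-- the parents of the non-root P-positions, at least |P| − 1 of them.  These parents are
-- N-positions and every N-position w is the parent of c(w): the prefix of length |P|
-- has at least n ∸ |P| distinct entries, while a prefix of length b < |P| has at most
-- n ∸ |P| < n ∸ b.  Thus α = |P|.
module Submission where

open import Defs
open import Data.Nat using (ℕ; zero; suc; _+_; _∸_; _≤_; _<_; z≤n; s≤s)
open import Data.Nat.Properties
  using (≤-trans; ≤-antisym; <⇒≱; <-cmp; ∸-monoʳ-<; m∸n+n≡m; ≤-pred; 1+n≰n; +-assoc; +-identityʳ)
open import Data.Fin using (Fin; _≟_)
import Data.Fin as Fin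
open import Data.Fin.Properties using (suc-injective; any?)
open import Data.Fin.Subset using (Subset; _∈_; ∣_∣; ∁)
open import Data.Fin.Subset.Properties using (∣p∣≤n; ∣⊤∣≡n; ∈⊤; ∣∁p∣≡n∸∣p∣; x∈∁p⇒x∉p; x∉p⇒x∈∁p)
open import Data.Vec using ([]; _∷_; tabulate; here; there)
open import Data.Vec.Properties using (lookup∘tabulate; []=⇒lookup; lookup⇒[]=)
open import Data.Bool using (Bool; true; false; not; _∨_; if_then_else_) renaming (T to So)
import Data.Bool as Bool
open import Data.Bool.Properties using (T-≡; T-∧; ¬-not; not-¬)
open import Data.List using (List; []; _∷_; _++_; [_]; map; length; take; allFin; filterᵇ; findᵇ; foldl)
open import Data.List.Properties using (length-map; length-++; take++drop≡id; take-map; ++-assoc; ++-identityʳ; length-removeAt′)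
open import Data.List.Relation.Unary.Any using (here; there)
import Data.List.Relation.Unary.Any as Any
open import Data.List.Relation.Unary.Any.Properties using (any⁺; any⁻)
open import Data.List.Relation.Unary.All using (All; []; _∷_)
import Data.List.Relation.Unary.All as All
open import Data.List.Relation.Unary.All.Properties using (all⁻)
import Data.List.Relation.Unary.All.Properties as All
open import Data.List.Relation.Unary.AllPairs using ([]; _∷_)
open import Data.List.Relation.Unary.Unique.Propositional using (Unique)
import Data.List.Relation.Unary.Unique.DecPropositional.Properties as UniqueDec
import Data.List.Relation.Unary.Unique.Propositional.Properties as Unique
open import Data.List.Membership.Propositional using (_─_) renaming (_∈_ to _∈ₗ_; _∉_ to _∉ₗ_)
open import Data.List.Membership.Propositional.Properties
  using (∈-map⁺; ∈-map⁻; ∈-++⁺ˡ; ∈-filter⁺; ∈-filter⁻; ∈-deduplicate⁺; ∈-deduplicate⁻; ∈-allFin)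
open import Data.List.Relation.Binary.Subset.Propositional using (_⊆_)
open import Data.List.Extrema.Nat using (max; xs≤max)
open import Data.Maybe using (just; nothing)
open import Data.Product using (_×_; _,_; ∃; proj₁; proj₂)
open import Data.Sum using (_⊎_; inj₁; inj₂)
open import Function using (_∘_; _⇔_; mk⇔; Equivalence)
open import Relation.Nullary using (¬_; yes; no; Dec; does; contradiction; ¬?)
open import Relation.Nullary.Decidable using (dec-true; _×-dec_) renaming (T? to So?)
open import Relation.Binary.PropositionalEquality using (_≡_; _≢_; refl; sym; trans; cong; subst; module ≡-Reasoning)
open import Relation.Binary.Definitions using (tri<; tri≈; tri>)

private
  variable
    A B : Set
    n : ℕ

∈-─⁺ : ∀ {x y : A} {ys} → x ∈ₗ ys → (p : y ∈ₗ ys) → x ≢ y → x ∈ₗ ys ─ p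
∈-─⁺ (here refl) (here refl) x≢y = contradiction refl x≢y
∈-─⁺ (there x∈ys) (here refl) _ = x∈ys
∈-─⁺ (here refl) (there _) _ = here refl
∈-─⁺ (there x∈ys) (there p) x≢y = there (∈-─⁺ x∈ys p x≢y)

Unique-⊆⇒length≤ : ∀ {xs ys : List A} → Unique xs → xs ⊆ ys → length xs ≤ length ys
Unique-⊆⇒length≤ [] _ = z≤n
Unique-⊆⇒length≤ {ys = ys} (x∉xs ∷ xs!) xs⊆ys =
  subst (_ ≤_) (sym (length-removeAt′ ys _))
    (s≤s (Unique-⊆⇒length≤ xs! λ x∈xs →
      ∈-─⁺ (xs⊆ys (there x∈xs)) (xs⊆ys (here refl)) (All.lookup x∉xs x∈xs ∘ sym)))

Unique-map⁺ : ∀ {f : A → B} {xs} → (∀ {x y} → x ∈ₗ xs → y ∈ₗ xs → f x ≡ f y → x ≡ y) →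
              Unique xs → Unique (map f xs)
Unique-map⁺ inj [] = []
Unique-map⁺ inj (x∉xs ∷ xs!) =
  All.map⁺ (All.tabulate λ y∈xs fx≡fy → All.lookup x∉xs y∈xs (inj (here refl) (there y∈xs) fx≡fy))
  ∷ Unique-map⁺ (λ x∈ y∈ → inj (there x∈) (there y∈)) xs!

take⊆ : ∀ b (xs : List A) → take b xs ⊆ xs
take⊆ b xs x∈ = subst (_ ∈ₗ_) (take++drop≡id b xs) (∈-++⁺ˡ x∈)

take-++-≤ : ∀ {b} (xs ys : List A) → b ≤ length xs → take b (xs ++ ys) ≡ take b xs
take-++-≤ {b = zero} xs ys _ = refl
take-++-≤ {b = suc b} (x ∷ xs) ys (s≤s b≤) = cong (x ∷_) (take-++-≤ xs ys b≤)

⊆-take-++ : ∀ {b} (xs ys : List A) → length xs ≤ b → xs ⊆ take b (xs ++ ys)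
⊆-take-++ {b = suc b} (x ∷ xs) ys _ (here refl) = here refl
⊆-take-++ {b = suc b} (x ∷ xs) ys (s≤s ≤b) (there x∈) = there (⊆-take-++ xs ys ≤b x∈)

findᵇ-just : ∀ (p : A → Bool) xs {v} → findᵇ p xs ≡ just v → So (p v)
findᵇ-just p (x ∷ xs) eq with p x in px
findᵇ-just p (x ∷ xs) refl | true = Equivalence.from T-≡ px
... | false = findᵇ-just p xs eq

findᵇ-nothing : ∀ (p : A → Bool) xs → findᵇ p xs ≡ nothing → ∀ {x} → x ∈ₗ xs → ¬ So (p x)
findᵇ-nothing p (x ∷ xs) eq x∈ with p x in px
findᵇ-nothing p (x ∷ xs) () x∈ | true
findᵇ-nothing p (x ∷ xs) eq (here refl) | false = subst So px
findᵇ-nothing p (x ∷ xs) eq (there x∈) | false = findᵇ-nothing p xs eq x∈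

So-not : ∀ {b} → So (not b) ⇔ (¬ So b)
So-not {false} = mk⇔ (λ _ ()) _
So-not {true} = mk⇔ (λ ()) (λ ¬b → ¬b _)

So-does : ∀ {Q : Set} {d : Dec Q} → So (does d) ⇔ Q
So-does {d = yes q} = mk⇔ (λ _ → q) _
So-does {d = no ¬q} = mk⇔ (λ ()) ¬q

So-eqb : ∀ {u v : Fin n} → So (eqb u v) ⇔ u ≡ v
So-eqb {u = u} {v} = So-does {d = u ≟ v}

So-memb : ∀ {v : Fin n} {xs} → So (memb v xs) ⇔ v ∈ₗ xs
So-memb = mk⇔ (Any.map (Equivalence.to So-eqb) ∘ any⁻ _ _) (any⁺ _ ∘ Any.map (Equivalence.from So-eqb))

elements : Subset n → List (Fin n)
elements [] = []
elements (true ∷ S) = Fin.zero ∷ map Fin.suc (elements S)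
elements (false ∷ S) = map Fin.suc (elements S)

length-elements : (S : Subset n) → length (elements S) ≡ ∣ S ∣
length-elements [] = refl
length-elements (true ∷ S) = cong suc (trans (length-map Fin.suc (elements S)) (length-elements S))
length-elements (false ∷ S) = trans (length-map Fin.suc (elements S)) (length-elements S)

elements-unique : (S : Subset n) → Unique (elements S)
elements-unique [] = []
elements-unique (true ∷ S) =
  All.map⁺ (All.universal (λ _ ()) (elements S)) ∷ Unique.map⁺ suc-injective (elements-unique S)
elements-unique (false ∷ S) = Unique.map⁺ suc-injective (elements-unique S)

∈-elements⁺ : ∀ (S : Subset n) {v} → v ∈ S → v ∈ₗ elements S
∈-elements⁺ (true ∷ S) here = here refl
∈-elements⁺ (true ∷ S) (there v∈S) = there (∈-map⁺ Fin.suc (∈-elements⁺ S v∈S))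
∈-elements⁺ (false ∷ S) (there v∈S) = ∈-map⁺ Fin.suc (∈-elements⁺ S v∈S)

∈-elements⁻ : ∀ (S : Subset n) {v} → v ∈ₗ elements S → v ∈ S
∈-elements⁻ (true ∷ S) (here refl) = here
∈-elements⁻ (true ∷ S) (there v∈) with ∈-map⁻ Fin.suc v∈
... | _ , w∈ , refl = there (∈-elements⁻ S w∈)
∈-elements⁻ (false ∷ S) v∈ with ∈-map⁻ Fin.suc v∈
... | _ , w∈ , refl = there (∈-elements⁻ S w∈)

∣∣≤length : ∀ {S : Subset n} {xs} → (∀ {v} → v ∈ S → v ∈ₗ xs) → ∣ S ∣ ≤ length xs
∣∣≤length {S = S} S⊆xs =
  subst (_≤ _) (length-elements S)
    (Unique-⊆⇒length≤ (elements-unique S) (S⊆xs ∘ ∈-elements⁻ S))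

length≤∣∣ : ∀ {S : Subset n} {xs} → Unique xs → (∀ {v} → v ∈ₗ xs → v ∈ S) → length xs ≤ ∣ S ∣
length≤∣∣ {S = S} xs! xs⊆S =
  subst (_ ≤_) (length-elements S) (Unique-⊆⇒length≤ xs! (∈-elements⁺ S ∘ xs⊆S))

∣∣-mono-injectiveOn : ∀ {S Q : Subset n} (f : Fin n → Fin n) → (∀ {v} → v ∈ S → f v ∈ Q) →
                      (∀ {u v} → u ∈ S → v ∈ S → f u ≡ f v → u ≡ v) → ∣ S ∣ ≤ ∣ Q ∣
∣∣-mono-injectiveOn {S = S} f f[S]⊆Q inj =
  subst (_≤ _) (trans (length-map f (elements S)) (length-elements S))
    (length≤∣∣ (Unique-map⁺ (λ u∈ v∈ → inj (∈-elements⁻ S u∈) (∈-elements⁻ S v∈)) (elements-unique S))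
      λ fv∈ → let _ , v∈ , fv≡ = ∈-map⁻ f fv∈ in subst (_∈ _) (sym fv≡) (f[S]⊆Q (∈-elements⁻ S v∈)))

∣∣≤distinctCount : ∀ {S : Subset n} {xs} → (∀ {v} → v ∈ S → v ∈ₗ xs) → ∣ S ∣ ≤ distinctCount xs
∣∣≤distinctCount S⊆xs = ∣∣≤length (∈-deduplicate⁺ _≟_ ∘ S⊆xs)

distinctCount≤∣∣ : ∀ {S : Subset n} {xs} → (∀ {v} → v ∈ₗ xs → v ∈ S) → distinctCount xs ≤ ∣ S ∣
distinctCount≤∣∣ {xs = xs} xs⊆S =
  length≤∣∣ (UniqueDec.deduplicate-! _≟_ xs) (xs⊆S ∘ ∈-deduplicate⁻ _≟_ xs)

∈-tabulate⇔ : ∀ {f : Fin n → Bool} {v} → v ∈ tabulate f ⇔ f v ≡ true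
∈-tabulate⇔ {f = f} {v} = mk⇔
  (λ v∈ → trans (sym (lookup∘tabulate f v)) ([]=⇒lookup v∈))
  (λ fv → lookup⇒[]= v _ (trans (lookup∘tabulate f v) fv))

∈-tabulate-does⇔ : ∀ {Q : Fin n → Set} {Q? : ∀ v → Dec (Q v)} {v} →
                   v ∈ tabulate (does ∘ Q?) ⇔ Q v
∈-tabulate-does⇔ {Q? = Q?} {v} = mk⇔
  (Equivalence.to (So-does {d = Q? v}) ∘ Equivalence.from T-≡ ∘ Equivalence.to ∈-tabulate⇔)
  (Equivalence.from ∈-tabulate⇔ ∘ dec-true (Q? v))

iter-fixed : ∀ {f : A → A} {x} → f x ≡ x → ∀ k → iter f k x ≡ x
iter-fixed fx≡x zero = refl
iter-fixed {f = f} fx≡x (suc k) = trans (cong f (iter-fixed fx≡x k)) fx≡x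

iter-+ : ∀ (f : A → A) j k x → iter f (j + k) x ≡ iter f j (iter f k x)
iter-+ f zero k x = refl
iter-+ f (suc j) k x = cong f (iter-+ f j k x)

module _ (T : RootedTree n) where

  reachesRoot-uniformly : ∃ λ K → ∀ v → iter (parent T) K v ≡ root T
  reachesRoot-uniformly = K , reach
    where
    depth : Fin n → ℕ
    depth v = proj₁ (reachesRoot T v)
    K : ℕ
    K = max 0 (map depth (allFin n))
    reach : ∀ v → iter (parent T) K v ≡ root T
    reach v = begin
      iter (parent T) K v                                       ≡⟨ cong (λ k → iter (parent T) k v) (sym (m∸n+n≡m depth≤K)) ⟩
      iter (parent T) (K ∸ depth v + depth v) v                 ≡⟨ iter-+ (parent T) (K ∸ depth v) (depth v) v ⟩
      iter (parent T) (K ∸ depth v) (iter (parent T) (depth v) v) ≡⟨ cong (iter (parent T) (K ∸ depth v)) (proj₂ (reachesRoot T v)) ⟩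
      iter (parent T) (K ∸ depth v) (root T)                    ≡⟨ iter-fixed (parent-root T) (K ∸ depth v) ⟩
      root T                                                    ∎
      where
      open ≡-Reasoning
      depth≤K : depth v ≤ K
      depth≤K = All.lookup (xs≤max 0 (map depth (allFin n))) (∈-map⁺ depth (∈-allFin v))

  -- Descending K steps inside Q from v ends at a vertex whose K-th ancestor is
  -- both v and the root.
  childClosed-empty : (Q : Fin n → Set) → (∀ {v} → Q v → v ≢ root T) →
                      (∀ {v} → Q v → ∃ λ c → Q c × parent T c ≡ v) → ∀ v → ¬ Q v
  childClosed-empty Q Q⇒nonRoot Q⇒child v Qv =
    let K , reach = reachesRoot-uniformly
        w , _ , w↝v = descend K Qv
    in Q⇒nonRoot Qv (trans (sym w↝v) (reach w))
    where
    descend : ∀ j {u} → Q u → ∃ λ w → Q w × iter (parent T) j w ≡ u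
    descend zero Qu = _ , Qu , refl
    descend (suc j) Qu =
      let c , Qc , c↑u = Q⇒child Qu
          w , Qw , w↝c = descend j Qc
      in w , Qw , trans (cong (parent T) w↝c) c↑u

-- The removal process

private
  2+[n∸1]≰n : ∀ n → ¬ suc (suc (n ∸ 1)) ≤ n
  2+[n∸1]≰n zero ()
  2+[n∸1]≰n (suc n) = 1+n≰n ∘ ≤-pred

module _ (T : RootedTree n) where

  ChildrenRemoved : List (Fin n) → Fin n → Set
  ChildrenRemoved rem v = ∀ u → u ≢ root T → parent T u ≡ v → u ∈ₗ rem

  -- In removable, not (eqb v (root T)) is does (¬? (v ≟ root T)) by definition of ¬?.
  removable⇒ : ∀ {rem v} → So (removable T rem v) → v ≢ root T × v ∉ₗ rem
  removable⇒ {rem} {v} isRemovable =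
    let v≢r , rest = Equivalence.to T-∧ isRemovable
        v∉ , _ = Equivalence.to T-∧ rest
    in Equivalence.to (So-does {d = ¬? (v ≟ root T)}) v≢r ,
       Equivalence.to So-not v∉ ∘ Equivalence.from So-memb

  childrenRemoved⇒removable : ∀ {rem v} → v ≢ root T → v ∉ₗ rem → ChildrenRemoved rem v →
                              So (removable T rem v)
  childrenRemoved⇒removable {rem} {v} v≢r v∉ done =
    Equivalence.from T-∧ (Equivalence.from (So-does {d = ¬? (v ≟ root T)}) v≢r ,
      Equivalence.from T-∧ (Equivalence.from So-not (v∉ ∘ Equivalence.to So-memb) ,
        all⁻ _ (All.tabulate⁺ childOk)))
    where
    childOk : ∀ u → So (not (eqb (parent T u) v) ∨ eqb u (root T) ∨ memb u rem)
    childOk u with parent T u ≟ v | u ≟ root T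
    ... | no _ | _ = _
    ... | yes _ | yes _ = _
    ... | yes pu≡v | no u≢r = Equivalence.from So-memb (done u u≢r pu≡v)

  unremovable⇒child : ∀ {rem v} → v ≢ root T → v ∉ₗ rem → ¬ So (removable T rem v) →
                      ∃ λ c → (c ≢ root T × c ∉ₗ rem) × parent T c ≡ v
  unremovable⇒child {rem} {v} v≢r v∉ unremovable
    with any? (λ c → (¬? (c ≟ root T) ×-dec ¬? (Any.any? (c ≟_) rem)) ×-dec (parent T c ≟ v))
  ... | yes child = child
  ... | no ∄child = contradiction (childrenRemoved⇒removable v≢r v∉ done) unremovable
    where
    done : ChildrenRemoved rem v
    done u u≢r pu≡v with Any.any? (u ≟_) rem
    ... | yes u∈ = u∈
    ... | no u∉ = contradiction (u , (u≢r , u∉) , pu≡v) ∄child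

  nextRemoved-just : ∀ {rem v} → nextRemoved T rem ≡ just v → v ≢ root T × v ∉ₗ rem
  nextRemoved-just {rem} = removable⇒ ∘ findᵇ-just (removable T rem) (allFin n)

  nextRemoved-nothing : ∀ {rem} → nextRemoved T rem ≡ nothing → ∀ v → v ≢ root T → v ∈ₗ rem
  nextRemoved-nothing {rem} stuck v v≢r with Any.any? (v ≟_) rem
  ... | yes v∈ = v∈
  ... | no v∉ = contradiction (v≢r , v∉) (childClosed-empty T Q proj₁ child v)
    where
    Q : Fin n → Set
    Q u = u ≢ root T × u ∉ₗ rem
    child : ∀ {u} → Q u → ∃ λ c → Q c × parent T c ≡ u
    child {u} (u≢r , u∉) =
      unremovable⇒child u≢r u∉ (findᵇ-nothing (removable T rem) (allFin n) stuck (∈-allFin u))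

  NonRootUnique : List (Fin n) → Set
  NonRootUnique xs = Unique xs × All (_≢ root T) xs

  NonRootUnique⇒length< : ∀ {xs} → NonRootUnique xs → length xs < n
  NonRootUnique⇒length< {xs} (xs! , xsNR) =
    subst (length (root T ∷ xs) ≤_) (∣⊤∣≡n n) (length≤∣∣ (All.map (_∘ sym) xsNR ∷ xs!) (λ _ → ∈⊤))

  removeSteps-NonRootUnique : ∀ k {rem} → NonRootUnique rem → NonRootUnique (removeSteps T k rem)
  removeSteps-NonRootUnique zero ok = ok
  removeSteps-NonRootUnique (suc k) {rem} (rem! , remNR) with nextRemoved T rem in eq
  ... | nothing = rem! , remNR
  ... | just v =
    let v≢r , v∉ = nextRemoved-just eq in
    removeSteps-NonRootUnique k
      (Unique.++⁺ rem! ([] ∷ []) (λ { (v∈ , here refl) → v∉ v∈ }) , All.++⁺ remNR (v≢r ∷ []))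

  removeSteps-complete-or-long : ∀ k rem → (∀ v → v ≢ root T → v ∈ₗ removeSteps T k rem) ⊎
                                           length (removeSteps T k rem) ≡ length rem + k
  removeSteps-complete-or-long zero rem = inj₂ (sym (+-identityʳ _))
  removeSteps-complete-or-long (suc k) rem with nextRemoved T rem in eq
  ... | nothing = inj₁ (nextRemoved-nothing eq)
  ... | just v with removeSteps-complete-or-long k (rem ++ [ v ])
  ...   | inj₁ complete = inj₁ complete
  ...   | inj₂ long = inj₂ (trans long (trans (cong (_+ k) (length-++ rem)) (+-assoc (length rem) 1 k)))

  removalOrder-NonRootUnique : NonRootUnique (removalOrder T)
  removalOrder-NonRootUnique = removeSteps-NonRootUnique (n ∸ 1) ([] , [])

  -- If all n ∸ 1 steps succeed, the removed vertices, a missing v and the root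
  -- would be n + 1 distinct vertices.
  removalOrder-complete : ∀ v → v ≢ root T → v ∈ₗ removalOrder T
  removalOrder-complete v v≢r with removeSteps-complete-or-long (n ∸ 1) []
  ... | inj₁ complete = complete v v≢r
  ... | inj₂ long with Any.any? (v ≟_) (removalOrder T)
  ...   | yes v∈ = v∈
  ...   | no v∉ =
    let out! , outNR = removalOrder-NonRootUnique in
    contradiction (subst (λ l → suc (suc l) ≤ n) long
                     (NonRootUnique⇒length< ((All.¬Any⇒All¬ _ v∉ ∷ out!) , (v≢r ∷ outNR))))
                  (2+[n∸1]≰n n)

-- P-positions

module PPositions (T : RootedTree n) {P : Fin n → Bool} (isP : IsPLabelling T P) where

  Ps : Subset n
  Ps = tabulate P

  Ns : Subset n
  Ns = ∁ Ps

  ∈Ns⇔ : ∀ {v} → v ∈ Ns ⇔ P v ≡ false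
  ∈Ns⇔ = mk⇔
    (λ v∈ → ¬-not (x∈∁p⇒x∉p v∈ ∘ Equivalence.from ∈-tabulate⇔))
    (λ Pv → x∉p⇒x∈∁p (not-¬ Pv ∘ Equivalence.to ∈-tabulate⇔))

  ∣Ns∣≡n∸∣Ps∣ : ∣ Ns ∣ ≡ n ∸ ∣ Ps ∣
  ∣Ns∣≡n∸∣Ps∣ = ∣∁p∣≡n∸∣p∣ Ps

  P⇒child-N : ∀ {v c} → P v ≡ true → IsChild T c v → P c ≡ false
  P⇒child-N {v} Pv c↑v = Equivalence.to (isP v) Pv _ c↑v

  P⇒parent-N : ∀ {v} → v ≢ root T → P v ≡ true → P (parent T v) ≡ false
  P⇒parent-N v≢r Pv = ¬-not λ Ppv → not-¬ (P⇒child-N Ppv (v≢r , refl)) Pv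

  IsPChild : Fin n → Fin n → Set
  IsPChild w c = IsChild T c w × P c ≡ true

  isPChild? : ∀ w c → Dec (IsPChild w c)
  isPChild? w c = (¬? (c ≟ root T) ×-dec (parent T c ≟ w)) ×-dec (P c Bool.≟ true)

  -- A P-child of w if there is one, as for every N-position; otherwise w itself,
  -- which is then a P-position.
  pChild : Fin n → Fin n
  pChild w with any? (isPChild? w)
  ... | yes (c , _) = c
  ... | no _ = w

  pChild-of-N : ∀ {w} → P w ≡ false → IsPChild w (pChild w)
  pChild-of-N {w} Nw with any? (isPChild? w)
  ... | yes (_ , isPChild) = isPChild
  ... | no ∄PChild = contradiction (Equivalence.from (isP w) λ c c↑w → ¬-not λ Pc → ∄PChild (c , c↑w , Pc))
                                   (not-¬ Nw)

  pChild-of-P : ∀ {w} → P w ≡ true → pChild w ≡ w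
  pChild-of-P {w} Pw with any? (isPChild? w)
  ... | yes (_ , c↑w , Pc) = contradiction (P⇒child-N Pw c↑w) (not-¬ Pc)
  ... | no _ = refl

  P-pChild : ∀ w → P (pChild w) ≡ true
  P-pChild w with P w in Pw
  ... | true = trans (cong P (pChild-of-P Pw)) Pw
  ... | false = proj₂ (pChild-of-N Pw)

  pChild-self-or-child : ∀ w → pChild w ≡ w ⊎ IsChild T (pChild w) w
  pChild-self-or-child w with P w in Pw
  ... | true = inj₁ (pChild-of-P Pw)
  ... | false = inj₂ (proj₁ (pChild-of-N Pw))

  Ps-independent : IsIndependent T Ps
  Ps-independent u v u∈ v∈ (inj₁ u↑v) =
    not-¬ (P⇒child-N (Equivalence.to ∈-tabulate⇔ v∈) u↑v) (Equivalence.to ∈-tabulate⇔ u∈)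
  Ps-independent u v u∈ v∈ (inj₂ v↑u) =
    not-¬ (P⇒child-N (Equivalence.to ∈-tabulate⇔ u∈) v↑u) (Equivalence.to ∈-tabulate⇔ v∈)

  -- pChild is injective on an independent set: two vertices with the same image
  -- are both that image or its parent, hence equal or adjacent.
  independent⇒∣∣≤∣Ps∣ : ∀ S → IsIndependent T S → ∣ S ∣ ≤ ∣ Ps ∣
  independent⇒∣∣≤∣Ps∣ S indep =
    ∣∣-mono-injectiveOn pChild (λ {v} _ → Equivalence.from ∈-tabulate⇔ (P-pChild v)) injective
    where
    injective : ∀ {u v} → u ∈ S → v ∈ S → pChild u ≡ pChild v → u ≡ v
    injective {u} {v} u∈ v∈ same with pChild-self-or-child u | pChild-self-or-child v
    ... | inj₁ u-self | inj₁ v-self = trans (sym u-self) (trans same v-self)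
    ... | inj₁ u-self | inj₂ v-child =
      contradiction (inj₁ (subst (λ c → IsChild T c v) (trans (sym same) u-self) v-child)) (indep u v u∈ v∈)
    ... | inj₂ u-child | inj₁ v-self =
      contradiction (inj₂ (subst (λ c → IsChild T c u) (trans same v-self) u-child)) (indep u v u∈ v∈)
    ... | inj₂ u-child | inj₂ v-child =
      trans (sym (proj₂ u-child)) (trans (cong (parent T) same) (proj₂ v-child))

  matching⇒∣∣≤∣Ns∣ : ∀ M → IsMatching T M → ∣ M ∣ ≤ ∣ Ns ∣
  matching⇒∣∣≤∣Ns∣ M (nonRoot , disjoint) = ∣∣-mono-injectiveOn NEnd NEnd∈Ns injective
    where
    NEnd : Fin n → Fin n
    NEnd v = if P v then parent T v else v
    NEnd∈Ns : ∀ {v} → v ∈ M → NEnd v ∈ Ns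
    NEnd∈Ns {v} v∈ with P v in Pv
    ... | true = Equivalence.from ∈Ns⇔ (P⇒parent-N (nonRoot v v∈) Pv)
    ... | false = Equivalence.from ∈Ns⇔ Pv
    injective : ∀ {u v} → u ∈ M → v ∈ M → NEnd u ≡ NEnd v → u ≡ v
    injective {u} {v} u∈ v∈ same with u ≟ v
    ... | yes u≡v = u≡v
    ... | no u≢v with P u | P v | disjoint u v u∈ v∈ u≢v
    ...   | true | true | _ , _ , pu≢pv = contradiction same pu≢pv
    ...   | true | false | _ , pu≢v , _ = contradiction same pu≢v
    ...   | false | true | u≢pv , _ , _ = contradiction same u≢pv
    ...   | false | false | _ = same

  IsMatchedEdge : Fin n → Set
  IsMatchedEdge v = P (parent T v) ≡ false × pChild (parent T v) ≡ v

  isMatchedEdge? : ∀ v → Dec (IsMatchedEdge v)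
  isMatchedEdge? v = (P (parent T v) Bool.≟ false) ×-dec (pChild (parent T v) ≟ v)

  Ms : Subset n
  Ms = tabulate (does ∘ isMatchedEdge?)

  Ms-matching : IsMatching T Ms
  Ms-matching = nonRoot , disjoint
    where
    matched : ∀ {v} → v ∈ Ms → IsMatchedEdge v
    matched = Equivalence.to (∈-tabulate-does⇔ {Q? = isMatchedEdge?})
    P-end : ∀ {v} → v ∈ Ms → P v ≡ true
    P-end v∈ = let _ , pChild≡v = matched v∈ in subst (λ c → P c ≡ true) pChild≡v (P-pChild _)
    nonRoot : ∀ v → v ∈ Ms → v ≢ root T
    nonRoot v v∈ = let Npv , pChild≡v = matched v∈ in
      subst (_≢ root T) pChild≡v (proj₁ (proj₁ (pChild-of-N Npv)))
    disjoint : ∀ v w → v ∈ Ms → w ∈ Ms → v ≢ w →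
               v ≢ parent T w × parent T v ≢ w × parent T v ≢ parent T w
    disjoint v w v∈ w∈ v≢w =
      (λ v≡pw → not-¬ (proj₁ (matched w∈)) (trans (sym (cong P v≡pw)) (P-end v∈))) ,
      (λ pv≡w → not-¬ (proj₁ (matched v∈)) (trans (cong P pv≡w) (P-end w∈))) ,
      (λ pv≡pw → v≢w (trans (sym (proj₂ (matched v∈))) (trans (cong pChild pv≡pw) (proj₂ (matched w∈)))))

  ∣Ns∣≤∣Ms∣ : ∣ Ns ∣ ≤ ∣ Ms ∣
  ∣Ns∣≤∣Ms∣ = ∣∣-mono-injectiveOn pChild into injective
    where
    parent-pChild : ∀ {w} → w ∈ Ns → parent T (pChild w) ≡ w
    parent-pChild w∈ = proj₂ (proj₁ (pChild-of-N (Equivalence.to ∈Ns⇔ w∈)))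
    into : ∀ {w} → w ∈ Ns → pChild w ∈ Ms
    into w∈ = Equivalence.from (∈-tabulate-does⇔ {Q? = isMatchedEdge?})
      ( trans (cong P (parent-pChild w∈)) (Equivalence.to ∈Ns⇔ w∈)
      , cong pChild (parent-pChild w∈))
    injective : ∀ {u w} → u ∈ Ns → w ∈ Ns → pChild u ≡ pChild w → u ≡ w
    injective u∈ w∈ same = trans (sym (parent-pChild u∈)) (trans (cong (parent T) same) (parent-pChild w∈))

  isIndependenceNumber : IsIndependenceNumber T ∣ Ps ∣
  isIndependenceNumber = (Ps , Ps-independent , refl) , independent⇒∣∣≤∣Ps∣

  isMatchingNumber : IsMatchingNumber T (n ∸ ∣ Ps ∣)
  isMatchingNumber =
    (Ms , Ms-matching , trans (≤-antisym (matching⇒∣∣≤∣Ns∣ Ms Ms-matching) ∣Ns∣≤∣Ms∣) ∣Ns∣≡n∸∣Ps∣) ,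
    λ M isMatching → subst (∣ M ∣ ≤_) ∣Ns∣≡n∸∣Ps∣ (matching⇒∣∣≤∣Ns∣ M isMatching)

-- The slither code

foldl-placeSlot : ∀ (P : Fin n → Bool) xs l r →
                  proj₁ (foldl (placeSlot P) (l , r) xs) ≡ l ++ filterᵇ P xs
foldl-placeSlot P [] l r = sym (++-identityʳ l)
foldl-placeSlot P (x ∷ xs) l r with P x
... | true = trans (foldl-placeSlot P xs (l ++ [ x ]) r) (++-assoc l [ x ] (filterᵇ P xs))
... | false = foldl-placeSlot P xs l (x ∷ r)

smallestAlpha-unique : ∀ {s : List (Fin n)} {a b} →
                       IsSmallestAlpha n s a → IsSmallestAlpha n s b → a ≡ b
smallestAlpha-unique {a = a} {b} (ca , mina) (cb , minb) with <-cmp a b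
... | tri< a<b _ _ = contradiction ca (minb a a<b)
... | tri≈ _ a≡b _ = a≡b
... | tri> _ _ b<a = contradiction cb (mina b b<a)

module SlitherCode (T : RootedTree n) {P : Fin n → Bool} (isP : IsPLabelling T P) where

  open PPositions T isP

  -- The slot word is L ++ R: the non-root P-positions fill the left slots in removal order.
  L : List (Fin n)
  L = filterᵇ P (removalOrder T)

  R : List (Fin n)
  R = proj₂ (foldl (placeSlot P) ([] , []) (removalOrder T))

  take-slitherCode : ∀ b → take b (slitherCode T P) ≡ map (parent T) (take b (L ++ R))
  take-slitherCode b =
    trans (cong (λ l → take b (map (parent T) (l ++ R))) (foldl-placeSlot P (removalOrder T) [] []))
          (take-map b (L ++ R))

  take-slitherCode-≤ : ∀ {b} → b ≤ length L → take b (slitherCode T P) ≡ map (parent T) (take b L)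
  take-slitherCode-≤ {b} b≤L = trans (take-slitherCode b) (cong (map (parent T)) (take-++-≤ L R b≤L))

  ∈L⇔ : ∀ {v} → v ∈ₗ L ⇔ (v ≢ root T × P v ≡ true)
  ∈L⇔ = mk⇔
    (λ v∈ → let v∈rem , Pv = ∈-filter⁻ (So? ∘ P) v∈ in
      All.lookup (proj₂ (removalOrder-NonRootUnique T)) v∈rem , Equivalence.to T-≡ Pv)
    (λ (v≢r , Pv) → ∈-filter⁺ (So? ∘ P) (removalOrder-complete T _ v≢r) (Equivalence.from T-≡ Pv))

  length-L≤∣Ps∣ : length L ≤ ∣ Ps ∣
  length-L≤∣Ps∣ = length≤∣∣ (Unique.filter⁺ (So? ∘ P) (proj₁ (removalOrder-NonRootUnique T)))
                    (Equivalence.from ∈-tabulate⇔ ∘ proj₂ ∘ Equivalence.to ∈L⇔)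

  ∣Ps∣≤1+length-L : ∣ Ps ∣ ≤ suc (length L)
  ∣Ps∣≤1+length-L = ∣∣≤length {xs = root T ∷ L} λ {v} v∈ → case-root v (Equivalence.to ∈-tabulate⇔ v∈)
    where
    case-root : ∀ v → P v ≡ true → v ∈ₗ root T ∷ L
    case-root v Pv with v ≟ root T
    ... | yes v≡r = here v≡r
    ... | no v≢r = there (Equivalence.from ∈L⇔ (v≢r , Pv))

  Ns⊆take : ∀ {b w} → length L ≤ b → w ∈ Ns → w ∈ₗ take b (slitherCode T P)
  Ns⊆take {b} {w} L≤b w∈ =
    subst (w ∈ₗ_) (sym (take-slitherCode b))
      (subst (_∈ₗ _) parent-pChild (∈-map⁺ (parent T) (⊆-take-++ L R L≤b pChild∈L)))
    where
    isPChild : IsPChild w (pChild w)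
    isPChild = pChild-of-N (Equivalence.to ∈Ns⇔ w∈)
    parent-pChild : parent T (pChild w) ≡ w
    parent-pChild = proj₂ (proj₁ isPChild)
    pChild∈L : pChild w ∈ₗ L
    pChild∈L = Equivalence.from ∈L⇔ (proj₁ (proj₁ isPChild) , proj₂ isPChild)

  take⊆Ns : ∀ {b v} → b ≤ length L → v ∈ₗ take b (slitherCode T P) → v ∈ Ns
  take⊆Ns {b} b≤L v∈ with ∈-map⁻ (parent T) (subst (_ ∈ₗ_) (take-slitherCode-≤ b≤L) v∈)
  ... | x , x∈ , refl =
    let x≢r , Px = Equivalence.to ∈L⇔ (take⊆ b L x∈) in Equivalence.from ∈Ns⇔ (P⇒parent-N x≢r Px)

  alphaCond-∣Ps∣ : AlphaCond n (slitherCode T P) ∣ Ps ∣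
  alphaCond-∣Ps∣ =
    subst (_≤ distinctCount (take ∣ Ps ∣ (slitherCode T P))) ∣Ns∣≡n∸∣Ps∣
      (∣∣≤distinctCount (Ns⊆take length-L≤∣Ps∣))

  ¬alphaCond-<∣Ps∣ : ∀ b → b < ∣ Ps ∣ → ¬ AlphaCond n (slitherCode T P) b
  ¬alphaCond-<∣Ps∣ b b<∣Ps∣ alphaCond = <⇒≱ (∸-monoʳ-< b<∣Ps∣ (∣p∣≤n Ps)) (≤-trans alphaCond distinct≤)
    where
    b≤L : b ≤ length L
    b≤L = ≤-pred (≤-trans b<∣Ps∣ ∣Ps∣≤1+length-L)
    distinct≤ : distinctCount (take b (slitherCode T P)) ≤ n ∸ ∣ Ps ∣
    distinct≤ = subst (distinctCount (take b (slitherCode T P)) ≤_) ∣Ns∣≡n∸∣Ps∣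
      (distinctCount≤∣∣ (take⊆Ns b≤L))

  isSmallestAlpha-∣Ps∣ : IsSmallestAlpha n (slitherCode T P) ∣ Ps ∣
  isSmallestAlpha-∣Ps∣ = alphaCond-∣Ps∣ , ¬alphaCond-<∣Ps∣

proposition6 : (n : ℕ) → 2 ≤ n → (T : RootedTree n) → (P : Fin n → Bool) →
    IsPLabelling T P → (α : ℕ) → IsSmallestAlpha n (slitherCode T P) α →
    IsIndependenceNumber T α × IsMatchingNumber T (n ∸ α)
proposition6 n _ T P isP α smallest =
  subst (λ a → IsIndependenceNumber T a × IsMatchingNumber T (n ∸ a))
    (smallestAlpha-unique isSmallestAlpha-∣Ps∣ smallest)
    (isIndependenceNumber , isMatchingNumber)
  where
  open PPositions T isP
  open SlitherCode T isP
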